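{- Let $G=(V,E)$ be a popular roommates instance, let $U\subseteq V$ and $Z=V\setminus(N(U)\cup U)$. Let $P$ be a popular matching of $G$ that leaves exactly the vertices of $U$ uncovered. Then every edge blocking $P$ connects two vertices that $P$ matches to vertices in $Z$.
   Context: A popular roommates instance is a simple graph $G=(V,E)$ in which every vertex $v$ has a strict preference order $\succ_v$ over its neighbours $N(v)$ (the graph need not be complete). For a matching $M$, $M(v)$ denotes the partner of $v$ in $M$, with $M(v)=v$ if $v$ is unmatched; every vertex prefers any neighbour to being unmatched. $N(U)$ is the set of vertices adjacent to at least one vertex of $U$. A vertex $v$ prefers matching $M$ to $M'$ if $v$ is matched in $M$ and unmatched in $M'$, or matched in both and $M(v)\succ_v M'(v)$. $M$ is popular if there is no matching $M'$ such that more vertices prefer $M'$ to $M$ than prefer $M$ to $M'$. An edge $(a,b)\notin M$ blocks $M$ if $b\succ_a M(a)$ and $a\succ_b M(b)$. -}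

module Defs where

open import Data.Nat using (ℕ; _<_; _≤_)
open import Data.Nat.Properties using (_<?_)
open import Data.Fin using (Fin)
open import Data.Fin.Properties using (_≟_)
open import Data.List using (List; length; filter)
open import Data.List.Base using (allFin)
open import Data.Product using (Σ; _×_; _,_; ∃)
open import Data.Sum using (_⊎_; inj₁; inj₂)
open import Relation.Nullary using (¬_; Dec; yes; no)
open import Relation.Nullary.Decidable using (_×-dec_; _⊎-dec_; ¬?)
open import Relation.Binary.PropositionalEquality using (_≡_; _≢_)

-- A popular roommates instance on the vertex set Fin n:
-- a simple graph (symmetric, irreflexive, decidable adjacency) together with,
-- for every vertex v, a strict preference order over N(v), encoded by a rank
-- function that is injective on N(v): a ≻_v b  iff  rank v a < rank v b.
record Instance (n : ℕ) : Set₁ where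
  field
    adj      : Fin n → Fin n → Set
    adj?     : ∀ u v → Dec (adj u v)
    adj-sym  : ∀ {u v} → adj u v → adj v u
    adj-irr  : ∀ {v} → ¬ adj v v
    rank     : Fin n → Fin n → ℕ
    rank-inj : ∀ {v a b} → adj v a → adj v b → rank v a ≡ rank v b → a ≡ b

module _ {n : ℕ} (G : Instance n) where
  open Instance G

  Pref : Fin n → Fin n → Fin n → Set
  Pref v a b = rank v a < rank v b

  record Matching : Set where
    field
      partner   : Fin n → Fin n
      involutive : ∀ v → partner (partner v) ≡ v
      edge      : ∀ v → partner v ≢ v → adj v (partner v)
  open Matching public

  Unmatched : Matching → Fin n → Set
  Unmatched M v = partner M v ≡ v

  Prefers : Fin n → Matching → Matching → Set
  Prefers v M M' =
      (partner M v ≢ v × partner M' v ≡ v)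
    ⊎ (partner M v ≢ v × partner M' v ≢ v × Pref v (partner M v) (partner M' v))

  prefers? : ∀ v M M' → Dec (Prefers v M M')
  prefers? v M M' =
      (¬? (partner M v ≟ v) ×-dec (partner M' v ≟ v))
    ⊎-dec (¬? (partner M v ≟ v) ×-dec (¬? (partner M' v ≟ v)
             ×-dec (rank v (partner M v) <? rank v (partner M' v))))

  votes : Matching → Matching → ℕ
  votes M M' = length (filter (λ v → prefers? v M M') (allFin n))

  Popular : Matching → Set
  Popular M = ∀ (M' : Matching) → votes M' M ≤ votes M M'

  -- x ≻_v y, where x is a neighbour of v and y is either a neighbour or v itself
  -- (every vertex prefers any neighbour to being unmatched)
  PrefOrUnm : Fin n → Fin n → Fin n → Set
  PrefOrUnm v x y = y ≡ v ⊎ (y ≢ v × Pref v x y)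

  Blocks : Matching → Fin n → Fin n → Set
  Blocks M a b =
    adj a b × partner M a ≢ b × PrefOrUnm a b (partner M a) × PrefOrUnm b a (partner M b)

  InZ : (Fin n → Set) → Fin n → Set
  InZ U z = ¬ U z × ¬ (∃ λ u → U u × adj u z)

-- Only vertices whose partner changes vote between two matchings, and none votes both
-- ways; so if more than half of the vertices rematched by M prefer M, P is not popular.
-- Rematching along a blocking edge (a , b) makes both a and b happier at the cost of at
-- most one vertex (the old partner of b) when a is unmatched in P; so a is matched.
-- If moreover an unmatched u is adjacent to a' = P(a), then rematching (a , b) and
-- (a' , u) makes a, b and u happier at the cost of at most a' and b'.  Hence a' is
-- neither uncovered nor a neighbour of an uncovered vertex.
module Submission where

open import Defs
open import Data.Nat using (ℕ; _≤_; _+_; suc; z≤n; s≤s)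
open import Data.Nat.Properties using (≤-trans; +-mono-≤; <-irrefl; <-asym)
open import Data.Fin using (Fin)
open import Data.Fin.Properties using (_≟_)
open import Data.Product using (_×_; _,_; proj₂)
open import Data.Sum using (_⊎_; inj₁; inj₂)
open import Data.Empty using (⊥-elim)
open import Data.List using (List; []; _∷_; _++_; length; filter; allFin)
open import Data.List.Properties using (length-++; length-++-sucʳ)
open import Data.List.Relation.Unary.All as All using (All; []; _∷_)
open import Data.List.Relation.Unary.AllPairs using ([]; _∷_)
open import Data.List.Relation.Unary.Any using (here; there; any?)
open import Data.List.Relation.Unary.Unique.Propositional using (Unique)
open import Data.List.Relation.Unary.Unique.Propositional.Properties using (allFin⁺; filter⁺; ++⁺)
open import Data.List.Membership.Propositional using (_∈_; _∉_)
open import Data.List.Membership.Propositional.Properties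
  using (∈-filter⁺; ∈-filter⁻; ∈-allFin; ∈-++⁻; ∈-++⁺ˡ; ∈-++⁺ʳ; ∈-∃++)
open import Function.Base using (_∘_)
open import Function.Bundles using (_⇔_; Equivalence)
open import Relation.Nullary using (¬_; yes; no)
open import Relation.Nullary.Decidable using (decidable-stable; _⊎-dec_)
open import Relation.Binary.PropositionalEquality using (_≡_; _≢_; refl; sym; trans; cong; subst)

Unique-⊆⇒length≤ : ∀ {a} {A : Set a} {xs ys : List A} →
                   Unique xs → (∀ {z} → z ∈ xs → z ∈ ys) → length xs ≤ length ys
Unique-⊆⇒length≤ [] _ = z≤n
Unique-⊆⇒length≤ {xs = x ∷ xs} (x∉xs ∷ xs!) xs⊆ys with ∈-∃++ (xs⊆ys (here refl))
... | l , r , refl = subst (suc (length xs) ≤_) (sym (length-++-sucʳ l x r))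
                           (s≤s (Unique-⊆⇒length≤ xs! xs⊆l++r))
  where
  xs⊆l++r : ∀ {z} → z ∈ xs → z ∈ l ++ r
  xs⊆l++r z∈xs with ∈-++⁻ l (xs⊆ys (there z∈xs))
  ... | inj₁ z∈l        = ∈-++⁺ˡ z∈l
  ... | inj₂ (here refl) = ⊥-elim (All.lookup x∉xs z∈xs refl)
  ... | inj₂ (there z∈r) = ∈-++⁺ʳ l z∈r

module _ {n : ℕ} (G : Instance n) where
  open Instance G

  adj⇒≢ : ∀ {u v} → adj u v → u ≢ v
  adj⇒≢ uv refl = adj-irr uv

  partner-flip : (M : Matching G) {v w : Fin n} → partner M v ≡ w → partner M w ≡ v
  partner-flip M {v} refl = involutive M v

  partner-injective : (M : Matching G) {v w : Fin n} → partner M v ≡ partner M w → v ≡ w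
  partner-injective M {v} e = trans (sym (partner-flip M refl)) (partner-flip M (sym e))

  Unmatched-partner : ∀ M {v} → Unmatched G M (partner M v) → Unmatched G M v
  Unmatched-partner M {v} unm = trans (sym unm) (involutive M v)

  unmatched≢matched : ∀ M {u v} → Unmatched G M u → ¬ Unmatched G M v → u ≢ v
  unmatched≢matched M u-unm v-matched refl = v-matched u-unm

  module _ (M : Matching G) {x y : Fin n} (xy : adj x y) where

    data Role (v : Fin n) : Set where
      is-x    : v ≡ x → Role v
      is-y    : v ≢ x → v ≡ y → Role v
      dropped : v ≢ x → v ≢ y → v ≡ partner M x ⊎ v ≡ partner M y → Role v
      kept    : v ≢ x → v ≢ y → v ≢ partner M x → v ≢ partner M y → Role v

    role : ∀ v → Role v
    role v with v ≟ x | v ≟ y | (v ≟ partner M x) ⊎-dec (v ≟ partner M y)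
    ... | yes v≡x | _       | _   = is-x v≡x
    ... | no v≢x  | yes v≡y | _   = is-y v≢x v≡y
    ... | no v≢x  | no v≢y  | yes old = dropped v≢x v≢y old
    ... | no v≢x  | no v≢y  | no ¬old = kept v≢x v≢y (¬old ∘ inj₁) (¬old ∘ inj₂)

    rematch-partner : Fin n → Fin n
    rematch-partner v with role v
    ... | is-x _        = y
    ... | is-y _ _      = x
    ... | dropped _ _ _ = v
    ... | kept _ _ _ _  = partner M v

    rematch-x : rematch-partner x ≡ y
    rematch-x with role x
    ... | is-x _           = refl
    ... | is-y x≢x _       = ⊥-elim (x≢x refl)
    ... | dropped x≢x _ _  = ⊥-elim (x≢x refl)
    ... | kept x≢x _ _ _   = ⊥-elim (x≢x refl)

    rematch-y : rematch-partner y ≡ x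
    rematch-y with role y
    ... | is-x y≡x         = ⊥-elim (adj⇒≢ xy (sym y≡x))
    ... | is-y _ _         = refl
    ... | dropped _ y≢y _  = ⊥-elim (y≢y refl)
    ... | kept _ y≢y _ _   = ⊥-elim (y≢y refl)

    rematch-dropped : ∀ {v} → v ≢ x → v ≢ y → v ≡ partner M x ⊎ v ≡ partner M y →
                      rematch-partner v ≡ v
    rematch-dropped {v} v≢x v≢y old with role v
    ... | is-x v≡x           = ⊥-elim (v≢x v≡x)
    ... | is-y _ v≡y         = ⊥-elim (v≢y v≡y)
    ... | dropped _ _ _      = refl
    ... | kept _ _ ≢Mx ≢My with old
    ...   | inj₁ v≡Mx = ⊥-elim (≢Mx v≡Mx)
    ...   | inj₂ v≡My = ⊥-elim (≢My v≡My)

    rematch-kept : ∀ {v} → v ≢ x → v ≢ y → v ≢ partner M x → v ≢ partner M y →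
                   rematch-partner v ≡ partner M v
    rematch-kept {v} v≢x v≢y ≢Mx ≢My with role v
    ... | is-x v≡x                = ⊥-elim (v≢x v≡x)
    ... | is-y _ v≡y              = ⊥-elim (v≢y v≡y)
    ... | dropped _ _ (inj₁ v≡Mx) = ⊥-elim (≢Mx v≡Mx)
    ... | dropped _ _ (inj₂ v≡My) = ⊥-elim (≢My v≡My)
    ... | kept _ _ _ _            = refl

    involutive-by-role : ∀ {v} → Role v → rematch-partner (rematch-partner v) ≡ v
    involutive-by-role (is-x refl) = trans (cong rematch-partner rematch-x) rematch-y
    involutive-by-role (is-y _ refl) = trans (cong rematch-partner rematch-y) rematch-x
    involutive-by-role (dropped v≢x v≢y old) =
      trans (cong rematch-partner (rematch-dropped v≢x v≢y old)) (rematch-dropped v≢x v≢y old)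
    involutive-by-role {v} (kept v≢x v≢y ≢Mx ≢My) =
      trans (cong rematch-partner (rematch-kept v≢x v≢y ≢Mx ≢My))
            (trans (rematch-kept (≢Mx ∘ sym ∘ partner-flip M) (≢My ∘ sym ∘ partner-flip M)
                                 (v≢x ∘ partner-injective M) (v≢y ∘ partner-injective M))
                   (involutive M v))

    edge-by-role : ∀ {v} → Role v → rematch-partner v ≢ v → adj v (rematch-partner v)
    edge-by-role (is-x refl) _ = subst (adj x) (sym rematch-x) xy
    edge-by-role (is-y _ refl) _ = subst (adj y) (sym rematch-y) (adj-sym xy)
    edge-by-role (dropped v≢x v≢y old) moved = ⊥-elim (moved (rematch-dropped v≢x v≢y old))
    edge-by-role {v} (kept v≢x v≢y ≢Mx ≢My) moved =
      subst (adj v) (sym (rematch-kept v≢x v≢y ≢Mx ≢My))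
            (edge M v (moved ∘ trans (rematch-kept v≢x v≢y ≢Mx ≢My)))

  rematch : (M : Matching G) {x y : Fin n} → adj x y → Matching G
  rematch M xy = record
    { partner    = rematch-partner M xy
    ; involutive = λ v → involutive-by-role M xy (role M xy v)
    ; edge       = λ v → edge-by-role M xy (role M xy v)
    }

  Prefers⇒moved : ∀ {v} M M' → Prefers G v M M' → partner M v ≢ partner M' v
  Prefers⇒moved M M' (inj₁ (matched , unmatched')) e = matched (trans e unmatched')
  Prefers⇒moved {v} M M' (inj₂ (_ , _ , better)) e = <-irrefl (cong (rank v) e) better

  Prefers-asym : ∀ {v} M M' → Prefers G v M M' → ¬ Prefers G v M' M
  Prefers-asym M M' (inj₁ (_ , unmatched')) (inj₁ (matched' , _)) = matched' unmatched'
  Prefers-asym M M' (inj₁ (_ , unmatched')) (inj₂ (matched' , _)) = matched' unmatched'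
  Prefers-asym M M' (inj₂ (matched , _)) (inj₁ (_ , unmatched)) = matched unmatched
  Prefers-asym M M' (inj₂ (_ , _ , better)) (inj₂ (_ , _ , worse)) = <-asym better worse

  PrefOrUnm⇒Prefers : ∀ {v w} (M M' : Matching G) → adj v w →
                      PrefOrUnm G v w (partner M' v) → partner M v ≡ w → Prefers G v M M'
  PrefOrUnm⇒Prefers M M' vw (inj₁ unmatched') refl = inj₁ (adj⇒≢ vw ∘ sym , unmatched')
  PrefOrUnm⇒Prefers M M' vw (inj₂ (matched' , better)) refl =
    inj₂ (adj⇒≢ vw ∘ sym , matched' , better)

  votes≥ : ∀ M M' {xs : List (Fin n)} → Unique xs → All (λ v → Prefers G v M M') xs →
           length xs ≤ votes G M M'
  votes≥ M M' xs! voters = Unique-⊆⇒length≤ xs! λ z∈xs →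
    ∈-filter⁺ (λ v → prefers? G v M M') (∈-allFin _) (All.lookup voters z∈xs)

  votes+votes≤moved : ∀ M M' (C : List (Fin n)) →
                      (∀ v → v ∉ C → partner M v ≡ partner M' v) →
                      votes G M M' + votes G M' M ≤ length C
  votes+votes≤moved M M' C unchanged =
    subst (_≤ length C) (length-++ for)
          (Unique-⊆⇒length≤ (++⁺ (filter⁺ _ (allFin⁺ n)) (filter⁺ _ (allFin⁺ n)) disjoint) ⊆C)
    where
    for against : List (Fin n)
    for     = filter (λ v → prefers? G v M M') (allFin n)
    against = filter (λ v → prefers? G v M' M) (allFin n)

    voter-for : ∀ {v} → v ∈ for → Prefers G v M M'
    voter-for = proj₂ ∘ ∈-filter⁻ (λ v → prefers? G v M M') {xs = allFin n}

    voter-against : ∀ {v} → v ∈ against → Prefers G v M' M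
    voter-against = proj₂ ∘ ∈-filter⁻ (λ v → prefers? G v M' M) {xs = allFin n}

    disjoint : ∀ {v} → ¬ (v ∈ for × v ∈ against)
    disjoint (v∈for , v∈against) = Prefers-asym M M' (voter-for v∈for) (voter-against v∈against)

    moved⇒∈C : ∀ {v} → partner M v ≢ partner M' v → v ∈ C
    moved⇒∈C {v} moved = decidable-stable (any? (v ≟_) C) (moved ∘ unchanged v)

    ⊆C : ∀ {v} → v ∈ for ++ against → v ∈ C
    ⊆C v∈ with ∈-++⁻ for v∈
    ... | inj₁ v∈for     = moved⇒∈C (Prefers⇒moved M M' (voter-for v∈for))
    ... | inj₂ v∈against = moved⇒∈C (Prefers⇒moved M' M (voter-against v∈against) ∘ sym)

  Popular⇒voters≤half-moved : ∀ P → Popular G P → (M : Matching G) {xs : List (Fin n)}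
    (C : List (Fin n)) → Unique xs → All (λ v → Prefers G v M P) xs →
    (∀ v → v ∉ C → partner M v ≡ partner P v) → length xs + length xs ≤ length C
  Popular⇒voters≤half-moved P pop M C xs! voters unchanged =
    ≤-trans (+-mono-≤ (votes≥ M P xs! voters) (≤-trans (votes≥ M P xs! voters) (pop M)))
            (votes+votes≤moved M P C unchanged)

  Blocks-sym : ∀ M {a b} → Blocks G M a b → Blocks G M b a
  Blocks-sym M {a} {b} (ab , Ma≢b , a-pref , b-pref) =
    adj-sym ab , Ma≢b ∘ partner-flip M , b-pref , a-pref

  module _ (P : Matching G) (pop : Popular G P) where

    blocking-matched : ∀ {a b} → Blocks G P a b → ¬ Unmatched G P a
    blocking-matched {a} {b} (ab , _ , a-pref , b-pref) a-unm =
      4≰3 (Popular⇒voters≤half-moved P pop M (a ∷ b ∷ partner P b ∷ [])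
             ((adj⇒≢ ab ∷ []) ∷ [] ∷ [])
             (PrefOrUnm⇒Prefers M P ab a-pref (rematch-x P ab)
               ∷ PrefOrUnm⇒Prefers M P (adj-sym ab) b-pref (rematch-y P ab) ∷ [])
             unchanged)
      where
      M : Matching G
      M = rematch P ab

      4≰3 : ¬ (4 ≤ 3)
      4≰3 (s≤s (s≤s (s≤s ())))

      unchanged : ∀ v → v ∉ a ∷ b ∷ partner P b ∷ [] → partner M v ≡ partner P v
      unchanged v v∉ = rematch-kept P ab (v∉ ∘ here) (v∉ ∘ there ∘ here)
                         (v∉ ∘ here ∘ λ v≡Pa → trans v≡Pa a-unm) (v∉ ∘ there ∘ there ∘ here)

    unmatched-¬adj-blocking-partner : ∀ {a b u} → Blocks G P a b → Unmatched G P u →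
                                      ¬ adj u (partner P a)
    unmatched-¬adj-blocking-partner {a} {b} {u} bl@(ab , a'≢b , a-pref , b-pref) u-unm ua' =
      6≰5 (Popular⇒voters≤half-moved P pop M (a ∷ b ∷ a' ∷ b' ∷ u ∷ [])
             ((adj⇒≢ ab ∷ u≢a ∘ sym ∷ []) ∷ (u≢b ∘ sym ∷ []) ∷ [] ∷ [])
             (PrefOrUnm⇒Prefers M P ab a-pref (trans (M-kept a≢a' (u≢a ∘ sym)) (rematch-x P ab))
               ∷ PrefOrUnm⇒Prefers M P (adj-sym ab) b-pref
                   (trans (M-kept (a'≢b ∘ sym) (u≢b ∘ sym)) (rematch-y P ab))
               ∷ PrefOrUnm⇒Prefers M P ua' (inj₁ u-unm) (rematch-y Q a'u) ∷ [])
             unchanged)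
      where
      a' b' : Fin n
      a' = partner P a
      b' = partner P b

      a'u : adj a' u
      a'u = adj-sym ua'

      Q M : Matching G
      Q = rematch P ab
      M = rematch Q a'u

      6≰5 : ¬ (6 ≤ 5)
      6≰5 (s≤s (s≤s (s≤s (s≤s (s≤s ())))))

      a≢a' : a ≢ a'
      a≢a' = blocking-matched bl ∘ sym

      u≢a : u ≢ a
      u≢a = unmatched≢matched P u-unm (blocking-matched bl)

      u≢b : u ≢ b
      u≢b = unmatched≢matched P u-unm (blocking-matched (Blocks-sym P bl))

      u≢a' : u ≢ a'
      u≢a' = unmatched≢matched P u-unm (blocking-matched bl ∘ Unmatched-partner P)

      u≢b' : u ≢ b'
      u≢b' = unmatched≢matched P u-unm (blocking-matched (Blocks-sym P bl) ∘ Unmatched-partner P)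

      Q-kept : ∀ {v} → v ≢ a → v ≢ b → v ≢ a' → v ≢ b' → partner Q v ≡ partner P v
      Q-kept = rematch-kept P ab

      Qa'≡a' : partner Q a' ≡ a'
      Qa'≡a' = rematch-dropped P ab (a≢a' ∘ sym) a'≢b (inj₁ refl)

      Qu≡u : partner Q u ≡ u
      Qu≡u = trans (Q-kept u≢a u≢b u≢a' u≢b') u-unm

      M-kept : ∀ {v} → v ≢ a' → v ≢ u → partner M v ≡ partner Q v
      M-kept v≢a' v≢u = rematch-kept Q a'u v≢a' v≢u (v≢a' ∘ λ e → trans e Qa'≡a')
                                                     (v≢u ∘ λ e → trans e Qu≡u)

      unchanged : ∀ v → v ∉ a ∷ b ∷ a' ∷ b' ∷ u ∷ [] → partner M v ≡ partner P v
      unchanged v v∉ =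
        trans (M-kept (v∉ ∘ there ∘ there ∘ here) (v∉ ∘ there ∘ there ∘ there ∘ there ∘ here))
              (Q-kept (v∉ ∘ here) (v∉ ∘ there ∘ here)
                      (v∉ ∘ there ∘ there ∘ here) (v∉ ∘ there ∘ there ∘ there ∘ here))

corollary1 : ∀ {n : ℕ} (G : Instance n) (U : Fin n → Set) (P : Matching G)
    → Popular G P
    → (∀ v → Unmatched G P v ⇔ U v)
    → ∀ a b → Blocks G P a b
    → InZ G U (partner P a) × InZ G U (partner P b)
corollary1 G U P pop uncovered a b bl = partner-in-Z bl , partner-in-Z (Blocks-sym G P bl)
  where
  unmatched : ∀ {v} → U v → Unmatched G P v
  unmatched {v} = Equivalence.from (uncovered v)

  partner-in-Z : ∀ {a b} → Blocks G P a b → InZ G U (partner P a)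
  partner-in-Z bl =
      blocking-matched G P pop bl ∘ Unmatched-partner G P ∘ unmatched
    , λ { (u , Uu , ua') → unmatched-¬adj-blocking-partner G P pop bl (unmatched Uu) ua' }
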